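{- Let $G=(V,E)$ be a finite bi-labelled $D$-regular graph with $D$ even, let $v\in V$, $i\in\{e,o\}$, and let $P(v,i)$ be the corresponding parity block. If $w$ is a vertex of $G$ having parity $i_w\in\{e,o\}$ in $P(v,i)$, then $P(v,i)=P(w,i_w)$.
   Context: Graphs may have loops and multiple edges. A bi-labelling of a $D$-regular graph $G=(V,E)$ assigns to every edge a colour in $[D]=\{1,\dots,D\}$ near each endpoint, the $D$ edges issuing from any vertex having distinct colours near it; the rotation map is $\mathrm{Rot}_G(v,h)=(w,k)$ if there is an edge joining $v,w$ coloured $h$ near $v$ and $k$ near $w$. Let $[D_e]$ and $[D_o]$ be the sets of even and odd elements of $[D]$. For $v\in V$ and $i\in\{e,o\}$, the parity block $P(v,i)$ is the subgraph of $G$ whose vertices are those $w\in V$ for which there is a walk $v=v_0,v_1,\dots,v_n=w$ with $\mathrm{Rot}_G(v_t,i_t)=(v_{t+1},j_t)$ for $t=0,\dots,n-1$, such that $i_0\in[D_i]$ and $i_{t+1}\equiv j_t\pmod 2$ for all $t$; its edges are the edges $\{v_t,v_{t+1}\}$ traversed by such walks, with the bi-labelling inherited from $G$. A vertex $w$ of $P(v,i)$ has parity $e$ (resp. $o$) in $P(v,i)$ if some such walk ending at $w$ has $j_{n-1}\in[D_e]$ (resp. $j_{n-1}\in[D_o]$); a vertex may have both parities. -}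

module Defs where

open import Data.Nat using (ℕ; suc)
open import Data.Nat.Base using (_%_)
open import Data.Fin using (Fin; toℕ)
open import Data.Product using (_×_; _,_; proj₁; proj₂; ∃; ∃-syntax)
open import Data.Sum using (_⊎_)
open import Relation.Binary.PropositionalEquality using (_≡_)
open import Function.Bundles using (_⇔_)

-- A finite bi-labelled D-regular graph (loops and multiple edges allowed),
-- given by its rotation map on vertex set Fin n and colour set Fin D.
-- Colour c : Fin D stands for the colour toℕ c + 1 ∈ [D] = {1,…,D}.
record BiLabelledGraph (n D : ℕ) : Set where
  field
    rot : Fin n → Fin D → Fin n × Fin D
    rot-invol : ∀ v h → rot (proj₁ (rot v h)) (proj₂ (rot v h)) ≡ (v , h)

data Par : Set where
  e o : Par

par : ∀ {D} → Fin D → Par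
par c with suc (toℕ c) % 2
... | 0 = e
... | _ = o

module _ {n D : ℕ} (G : BiLabelledGraph n D) where
  open BiLabelledGraph G

  -- WalkEnd v i w j : there is a walk v = v₀,…,v_m = w with m ≥ 1,
  -- Rot(v_t,i_t) = (v_{t+1},j_t), i₀ of parity i, i_{t+1} ≡ j_t (mod 2),
  -- whose last arrival colour j_{m-1} is j.
  data WalkEnd (v : Fin n) (i : Par) : Fin n → Fin D → Set where
    start : ∀ h → par h ≡ i →
            WalkEnd v i (proj₁ (rot v h)) (proj₂ (rot v h))
    step  : ∀ {u j} h → WalkEnd v i u j → par h ≡ par j →
            WalkEnd v i (proj₁ (rot u h)) (proj₂ (rot u h))

  -- vertices of P(v,i): v itself (walk of length 0) or the end of some walk
  VertexOf : Fin n → Par → Fin n → Set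
  VertexOf v i w = w ≡ v ⊎ ∃[ j ] WalkEnd v i w j

  HasParity : Fin n → Par → Fin n → Par → Set
  HasParity v i w p = ∃[ j ] (WalkEnd v i w j × par j ≡ p)

  -- the dart (u,h) is traversed (as some step (v_t,i_t)) by an admissible walk
  DartUsed : Fin n → Par → Fin n → Fin D → Set
  DartUsed v i u h = (u ≡ v × par h ≡ i) ⊎ ∃[ j ] (WalkEnd v i u j × par h ≡ par j)

  EdgeOf : Fin n → Par → Fin n → Fin D → Set
  EdgeOf v i u h = DartUsed v i u h ⊎ DartUsed v i (proj₁ (rot u h)) (proj₂ (rot u h))

  -- equality of parity blocks as subgraphs (same vertices, same edges;
  -- the bi-labelling is inherited from G)
  SameBlock : Fin n → Par → Fin n → Par → Set
  SameBlock v i w i' =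
    (∀ u → VertexOf v i u ⇔ VertexOf w i' u) ×
    (∀ u h → EdgeOf v i u h ⇔ EdgeOf w i' u h)

Even : ℕ → Set
Even D = D % 2 ≡ 0

module Submission where

-- Call (w , q) reachable from (v , p) when w has parity q in
-- P(v , p), i.e. some admissible walk from v with first colour of parity p
-- ends at w with last arrival colour of parity q.  Admissible walks can be
-- concatenated, since the continuation rule only asks that the next colour
-- have the parity of the last arrival colour; and they can be reversed, since
-- the rotation map is an involution, so traversing the walk backwards is again
-- admissible with the roles of first and last colour exchanged.  Hence
-- reachability is transitive and symmetric.  If (v , p) reaches (w , q), then
-- every walk of P(w , q) can be prefixed by a walk from v, so the vertices,
-- traversed darts and edges of P(w , q) lie in P(v , p); by symmetry the
-- converse inclusion holds as well, which gives P(v , i) = P(w , i_w).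

open import Defs
open import Data.Nat using (ℕ)
open import Data.Fin using (Fin)
open import Data.Product using (_,_; proj₁; proj₂)
open import Data.Sum using (inj₁; inj₂)
open import Relation.Binary.PropositionalEquality using (refl; sym; trans; subst)
open import Function.Bundles using (mk⇔)

module Walks {n D : ℕ} (G : BiLabelledGraph n D) where
  open BiLabelledGraph G

  _++ʷ_ : ∀ {a p b k c l} →
          WalkEnd G a p b k → WalkEnd G b (par k) c l → WalkEnd G a p c l
  W ++ʷ start h ph = step h W ph
  W ++ʷ step h V ph = step h (W ++ʷ V) ph

  -- Traversing the edge at dart (u , h) backwards: by involutivity of the
  -- rotation map, leaving Rot(u , h) along its colour arrives at u via h.
  backEdge : ∀ u h → WalkEnd G (proj₁ (rot u h)) (par (proj₂ (rot u h))) u h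
  backEdge u h =
    subst (λ d → WalkEnd G (proj₁ (rot u h)) (par (proj₂ (rot u h))) (proj₁ d) (proj₂ d))
          (rot-invol u h) (start (proj₂ (rot u h)) refl)

  reverse : ∀ {a p b j} → WalkEnd G a p b j → HasParity G b (par j) a p
  reverse (start h ph) = h , backEdge _ h , ph
  reverse (step {u} h W ph) with reverse W
  ... | k , W′ , pk = k , backEdge u h ++ʷ subst (λ q → WalkEnd G u q _ k) (sym ph) W′ , pk

  reach-trans : ∀ {a p b q c r} →
                HasParity G a p b q → HasParity G b q c r → HasParity G a p c r
  reach-trans (j , W , refl) (k , V , pk) = k , W ++ʷ V , pk

  reach-sym : ∀ {a p b q} → HasParity G a p b q → HasParity G b q a p
  reach-sym (j , W , refl) = reverse W

  module Inclusion {a p b q} (R : HasParity G b q a p) where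

    vertex⊆ : ∀ u → VertexOf G a p u → VertexOf G b q u
    vertex⊆ u (inj₁ refl) = inj₂ (proj₁ R , proj₁ (proj₂ R))
    vertex⊆ u (inj₂ (j , W)) with reach-trans R (j , W , refl)
    ... | k , V , _ = inj₂ (k , V)

    dart⊆ : ∀ u h → DartUsed G a p u h → DartUsed G b q u h
    dart⊆ u h (inj₁ (refl , refl)) = inj₂ (proj₁ R , proj₁ (proj₂ R) , sym (proj₂ (proj₂ R)))
    dart⊆ u h (inj₂ (j , W , ph)) with reach-trans R (j , W , refl)
    ... | k , V , pk = inj₂ (k , V , trans ph (sym pk))

    edge⊆ : ∀ u h → EdgeOf G a p u h → EdgeOf G b q u h
    edge⊆ u h (inj₁ d) = inj₁ (dart⊆ u h d)
    edge⊆ u h (inj₂ d) = inj₂ (dart⊆ (proj₁ (rot u h)) (proj₂ (rot u h)) d)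

open Walks

lemma4p1 : {n D : ℕ} (G : BiLabelledGraph n D) → Even D →
    (v : Fin n) (i : Par) (w : Fin n) (iw : Par) →
    HasParity G v i w iw → SameBlock G v i w iw
lemma4p1 G _ v i w iw reach =
  (λ u → mk⇔ (W⊆V.vertex⊆ u) (V⊆W.vertex⊆ u)) ,
  (λ u h → mk⇔ (W⊆V.edge⊆ u h) (V⊆W.edge⊆ u h))
  where
  module V⊆W = Inclusion G reach
  module W⊆V = Inclusion G (reach-sym G reach)
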